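{- Let $k,\Delta\geq 2$ and let $T$ be a $[\Delta,k]$-transversal design with groups $D_1,D_2,\ldots,D_\Delta$. Let $U$ be a block of $T$ and, for each $i\in\{1,\ldots,\Delta\}$, let $r_i$ be the unique node of $D_i$ adjacent to $U$; set $R=\{r_1,\ldots,r_\Delta\}$. Let $P$ be a set of distinct unordered pairs of nodes of $T$ such that: exactly one node of each pair in $P$ lies in $R$; no node of $R$ lies in more than one pair of $P$; and no pair in $P$ has both of its nodes in the same group. Then the blocks generated by the pairs in $P$ are pairwise distinct and all different from $U$.
   Context: A $[\Delta,k]$-transversal design ($k,\Delta\ge 2$) is a set $\mathcal{X}$ of $\Delta k$ elements partitioned into $\Delta$ groups $D_1,\ldots,D_\Delta$ of size $k$, together with a family of $k^2$ subsets of $\mathcal{X}$ called blocks, each of size $\Delta$, such that every block meets every group in exactly one element, and every pair of elements lying in distinct groups is contained in exactly one block. It is regarded as a bipartite graph whose nodes are the elements of $\mathcal{X}$ and whose blocks are the blocks, with a node adjacent to a block iff it belongs to it. If $x,y$ are nodes in distinct groups, the block generated by $x$ and $y$ is the unique block adjacent to both. -}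

module Defs where

open import Data.Nat using (ℕ; _*_)
open import Data.Fin using (Fin)
open import Data.Product using (Σ; ∃; ∃!; _×_; _,_; proj₁; proj₂)
open import Data.Sum using (_⊎_)
open import Relation.Nullary using (¬_)
open import Relation.Binary.PropositionalEquality using (_≡_; _≢_)

-- Nodes (elements) of a [Δ,k]-transversal design: the element set X of size Δk,
-- partitioned into groups D_1..D_Δ of size k, is taken to be Fin Δ × Fin k,
-- with group D_i = { (i , j) | j : Fin k }.
Point : ℕ → ℕ → Set
Point Δ k = Fin Δ × Fin k

group : ∀ {Δ k} → Point Δ k → Fin Δ
group = proj₁

record TD (Δ k : ℕ) : Set₁ where
  field
    _∈B_  : Point Δ k → Fin (k * k) → Set
    meets : ∀ (b : Fin (k * k)) (i : Fin Δ) → ∃! _≡_ (λ j → (i , j) ∈B b)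
    pairs : ∀ (x y : Point Δ k) → group x ≢ group y →
            ∃! _≡_ (λ b → x ∈B b × y ∈B b)

open TD public

rNode : ∀ {Δ k} (T : TD Δ k) (U : Fin (k * k)) → Fin Δ → Point Δ k
rNode T U i = i , proj₁ (meets T U i)

InR : ∀ {Δ k} (T : TD Δ k) (U : Fin (k * k)) → Point Δ k → Set
InR T U z = ∃ λ i → rNode T U i ≡ z

gen : ∀ {Δ k} (T : TD Δ k) (x y : Point Δ k) → group x ≢ group y → Fin (k * k)
gen T x y ne = proj₁ (pairs T x y ne)

SameUnordered : ∀ {A : Set} → A × A → A × A → Set
SameUnordered (a , b) (c , d) = (a ≡ c × b ≡ d) ⊎ (a ≡ d × b ≡ c)

_∈pair_ : ∀ {A : Set} → A → A × A → Set
z ∈pair (a , b) = (z ≡ a) ⊎ (z ≡ b)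

ExactlyOne : ∀ {A : Set} → (A → Set) → A × A → Set
ExactlyOne Q (a , b) = (Q a × ¬ Q b) ⊎ (¬ Q a × Q b)

-- Each pair of P contains a node r of R, and the block it generates contains r.
-- Such a block is not U, since the other node of the pair would then be adjacent
-- to U and so lie in R.  If two pairs generated the same block B, their R-nodes
-- are distinct (no node of R lies in two pairs), hence in distinct groups, and
-- lie both in B and in U; uniqueness of the block through them forces B = U.
module Submission where

open import Defs
open import Data.Nat using (ℕ; _*_; _≤_)
open import Data.Fin using (Fin; _≟_)
open import Data.Product using (_×_; proj₁; proj₂; _,_; Σ-syntax)
open import Data.Sum using (inj₁; inj₂)
open import Relation.Nullary using (¬_; yes; no)
open import Relation.Binary.PropositionalEquality
  using (_≡_; _≢_; refl; sym; trans; cong; subst)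

module _ {Δ k : ℕ} (T : TD Δ k) where

  gen-∈ˡ : ∀ x y (d : group x ≢ group y) → _∈B_ T x (gen T x y d)
  gen-∈ˡ x y d = proj₁ (proj₁ (proj₂ (pairs T x y d)))

  gen-∈ʳ : ∀ x y (d : group x ≢ group y) → _∈B_ T y (gen T x y d)
  gen-∈ʳ x y d = proj₂ (proj₁ (proj₂ (pairs T x y d)))

  gen-unique : ∀ x y (d : group x ≢ group y) {b} →
               _∈B_ T x b → _∈B_ T y b → gen T x y d ≡ b
  gen-unique x y d x∈b y∈b = proj₂ (proj₂ (pairs T x y d)) (x∈b , y∈b)

  module _ (U : Fin (k * k)) where

    ∈U⇒InR : ∀ z → _∈B_ T z U → InR T U z
    ∈U⇒InR (i , j) z∈U = i , cong (i ,_) (proj₂ (proj₂ (meets T U i)) z∈U)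

    rNode-∈U : ∀ i → _∈B_ T (rNode T U i) U
    rNode-∈U i = proj₁ (proj₂ (meets T U i))

    shared-rNodes⇒≡U : ∀ {i j b} → i ≢ j →
                       _∈B_ T (rNode T U i) b → _∈B_ T (rNode T U j) b → b ≡ U
    shared-rNodes⇒≡U {i} {j} i≢j ri∈b rj∈b =
      trans (sym (gen-unique ri rj i≢j ri∈b rj∈b))
            (gen-unique ri rj i≢j (rNode-∈U i) (rNode-∈U j))
      where
        ri = rNode T U i
        rj = rNode T U j

    gen≢U : ∀ x y (d : group x ≢ group y) →
            ExactlyOne (InR T U) (x , y) → gen T x y d ≢ U
    gen≢U x y d (inj₁ (_ , y∉R)) eq =
      y∉R (∈U⇒InR y (subst (_∈B_ T y) eq (gen-∈ʳ x y d)))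
    gen≢U x y d (inj₂ (x∉R , _)) eq =
      x∉R (∈U⇒InR x (subst (_∈B_ T x) eq (gen-∈ˡ x y d)))

    gen-rNode : ∀ x y (d : group x ≢ group y) → ExactlyOne (InR T U) (x , y) →
                Σ[ i ∈ Fin Δ ] rNode T U i ∈pair (x , y) × _∈B_ T (rNode T U i) (gen T x y d)
    gen-rNode x y d (inj₁ ((i , refl) , _)) = i , inj₁ refl , gen-∈ˡ x y d
    gen-rNode x y d (inj₂ (_ , (i , refl))) = i , inj₂ refl , gen-∈ʳ x y d

lemma1 : (Δ k : ℕ) → 2 ≤ Δ → 2 ≤ k →
    (T : TD Δ k) (U : Fin (k * k)) →
    (m : ℕ) (P : Fin m → Point Δ k × Point Δ k) →
    (∀ i j → i ≢ j → ¬ SameUnordered (P i) (P j)) →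
    (∀ i → ExactlyOne (InR T U) (P i)) →
    (∀ z → InR T U z → ∀ i j → z ∈pair P i → z ∈pair P j → i ≡ j) →
    (diff : ∀ i → group (proj₁ (P i)) ≢ group (proj₂ (P i))) →
    (∀ i j → i ≢ j →
       gen T (proj₁ (P i)) (proj₂ (P i)) (diff i) ≢ gen T (proj₁ (P j)) (proj₂ (P j)) (diff j))
    × (∀ i → gen T (proj₁ (P i)) (proj₂ (P i)) (diff i) ≢ U)
lemma1 Δ k _ _ T U m P _ one-in-R R-once diff = distinct , ≢U
  where
    B : Fin m → Fin (k * k)
    B p = gen T (proj₁ (P p)) (proj₂ (P p)) (diff p)

    ≢U : ∀ p → B p ≢ U
    ≢U p = gen≢U T U (proj₁ (P p)) (proj₂ (P p)) (diff p) (one-in-R p)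

    distinct : ∀ p q → p ≢ q → B p ≢ B q
    distinct p q p≢q Bp≡Bq
      with gen-rNode T U (proj₁ (P p)) (proj₂ (P p)) (diff p) (one-in-R p)
         | gen-rNode T U (proj₁ (P q)) (proj₂ (P q)) (diff q) (one-in-R q)
    ... | i , ri∈Pp , ri∈Bp | j , rj∈Pq , rj∈Bq with i ≟ j
    ... | yes refl = p≢q (R-once (rNode T U i) (i , refl) p q ri∈Pp rj∈Pq)
    ... | no i≢j   = ≢U p (shared-rNodes⇒≡U T U i≢j ri∈Bp
                             (subst (_∈B_ T (rNode T U j)) (sym Bp≡Bq) rj∈Bq))
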